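{- Let $G$ be a finite simple graph with $\chi_\delta(G)\geq 2$. If $d_G(v)\neq d_G(u)+1$ for all $u,v\in V(G)$, then $\chi_\delta(G\square P_3)\leq 2\chi_\delta(G)$.
   Context: All graphs are finite and simple; $d_G(x)$ denotes the degree of $x$ in $G$; $P_3$ is the path on 3 vertices. The $\delta$-complement $G_\delta$ of a graph $G$ is the graph on $V(G)$ in which distinct $u,v$ are adjacent iff either ($d_G(u)=d_G(v)$ and $uv\notin E(G)$) or ($d_G(u)\neq d_G(v)$ and $uv\in E(G)$). The $\delta$-chromatic number $\chi_\delta(G)$ is the chromatic number of $G_\delta$. The Cartesian product $G\square H$ has vertex set $V(G)\times V(H)$, with $(x,y)$ adjacent to $(x',y')$ iff either $x=x'$ and $yy'\in E(H)$, or $y=y'$ and $xx'\in E(G)$. -}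

module Defs where

open import Data.Nat using (ℕ; zero; suc; _*_; _≤_; _≡ᵇ_)
open import Data.Fin using (Fin; zero; suc; remQuot) renaming (_≟_ to _≟ᶠ_)
open import Data.Bool using (Bool; true; false; not; _∧_; _∨_; if_then_else_)
open import Data.List using (List; map; allFin)
open import Data.Nat.ListAction using (sum)
open import Data.Product using (Σ; _×_; _,_)
open import Relation.Nullary using (¬_; does)
open import Relation.Binary.PropositionalEquality using (_≡_; _≢_)

Adj : ℕ → Set
Adj n = Fin n → Fin n → Bool

record IsSimple {n : ℕ} (G : Adj n) : Set where
  field
    symmetric   : ∀ u v → G u v ≡ G v u
    irreflexive : ∀ u → G u u ≡ false

deg : {n : ℕ} → Adj n → Fin n → ℕ
deg {n} G u = sum (map (λ v → if G u v then 1 else 0) (allFin n))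

δ-complement : {n : ℕ} → Adj n → Adj n
δ-complement G u v =
  if deg G u ≡ᵇ deg G v
  then (not (G u v) ∧ not (does (u ≟ᶠ v)))
  else G u v

P₃ : Adj 3
P₃ zero (suc zero) = true
P₃ (suc zero) zero = true
P₃ (suc zero) (suc (suc zero)) = true
P₃ (suc (suc zero)) (suc zero) = true
P₃ _ _ = false

-- Cartesian product G □ H on Fin (m * k) ≅ Fin m × Fin k (via remQuot)
_□_ : {m k : ℕ} → Adj m → Adj k → Adj (m * k)
_□_ {m} {k} G H i j with remQuot {m} k i | remQuot {m} k j
... | (x , y) | (x' , y') =
  (does (x ≟ᶠ x') ∧ H y y') ∨ (does (y Data.Fin.≟ y') ∧ G x x')

Colourable : {n : ℕ} → Adj n → ℕ → Set
Colourable {n} G k =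
  Σ (Fin n → Fin k) λ c → ∀ u v → G u v ≡ true → c u ≢ c v

IsChromaticNumber : {n : ℕ} → Adj n → ℕ → Set
IsChromaticNumber G k = Colourable G k × (∀ j → Colourable G j → k ≤ j)

IsδChromaticNumber : {n : ℕ} → Adj n → ℕ → Set
IsδChromaticNumber G k = IsChromaticNumber (δ-complement G) k

-- Colour the three copies of G with two palettes of size k = χ_δ(G): the
-- end copies G × {0} and G × {2} get a δ-colouring c of G from different
-- palettes, and the middle copy gets c followed by a fixed-point-free
-- permutation of the first palette (this needs k ≥ 2).  Within a copy the
-- δ-complement of G □ P₃ is the δ-complement of G, since all degrees are
-- shifted by the same amount.  Between the two copies sharing a palette, a
-- δ-edge joins (x,0) and (x',1) with x ≠ x' only if d(x) + 1 = d(x') + 2,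
-- which the degree hypothesis forbids.
module Submission where

open import Defs
open import Data.Nat using (ℕ; zero; suc; _+_; _*_; _≤_; _≡ᵇ_; s≤s; z≤n)
open import Data.Fin using (Fin; zero; suc; _↑ˡ_; _↑ʳ_; combine; remQuot; splitAt; inject₁; fromℕ; _≟_)
open import Data.Bool using (Bool; true; false; _∧_; _∨_; if_then_else_)
open import Data.Bool.Properties using (∧-zeroʳ; ∨-identityʳ; T-≡)
open import Data.Fin.Patterns using (0F; 1F; 2F)
open import Data.Fin.Properties using (↑ˡ-injective; ↑ʳ-injective; splitAt-↑ˡ; splitAt-↑ʳ; remQuot-combine; combine-remQuot; combine-injectiveˡ; fromℕ≢inject₁; inject₁-injective; suc-injective)
open import Data.List using (map; tabulate; allFin)
open import Data.List.Properties using (map-tabulate)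
open import Data.Nat.ListAction using (sum)
open import Data.Nat.Properties as Nat using (+-assoc; +-comm; +-identityʳ; +-suc; +-cancelʳ-≡; ≡ᵇ⇒≡)
open import Algebra.Properties.CommutativeMonoid.Sum Nat.+-0-commutativeMonoid
  using (sum-syntax; sum-cong-≗; sum-replicate-zero; ∑-distrib-+)
open import Data.Product using (_×_; _,_; uncurry)
open import Function using (_∘_; Equivalence)
open import Relation.Nullary using (does; yes; no; contradiction)
open import Relation.Nullary.Decidable using (dec-true; dec-false)
open import Relation.Binary.PropositionalEquality using (_≡_; _≢_; refl; sym; trans; cong; cong₂; subst; subst₂; module ≡-Reasoning)

open ≡-Reasoning

sum-tabulate : ∀ {n} (f : Fin n → ℕ) → sum (tabulate f) ≡ ∑[ i < n ] f i
sum-tabulate {zero}  f = refl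
sum-tabulate {suc n} f = cong (f zero +_) (sum-tabulate (f ∘ suc))

sum-map-allFin : ∀ {n} (f : Fin n → ℕ) → sum (map f (allFin n)) ≡ ∑[ i < n ] f i
sum-map-allFin f = trans (cong sum (map-tabulate (λ i → i) f)) (sum-tabulate f)

∑-↑ : ∀ m {n} (f : Fin (m + n) → ℕ) →
      ∑[ i < m + n ] f i ≡ ∑[ i < m ] f (i ↑ˡ n) + ∑[ j < n ] f (m ↑ʳ j)
∑-↑ zero    f = refl
∑-↑ (suc m) f = trans (cong (f zero +_) (∑-↑ m (f ∘ suc))) (sym (+-assoc (f zero) _ _))

∑-combine : ∀ m n (f : Fin (m * n) → ℕ) →
            ∑[ i < m * n ] f i ≡ ∑[ x < m ] ∑[ y < n ] f (combine x y)
∑-combine zero    n f = refl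
∑-combine (suc m) n f =
  trans (∑-↑ n f) (cong (∑[ y < n ] f (y ↑ˡ m * n) +_) (∑-combine m n (f ∘ (n ↑ʳ_))))

∑-indicator : ∀ {n} (x : Fin n) (c : ℕ) → ∑[ x' < n ] (if does (x ≟ x') then c else 0) ≡ c
∑-indicator {suc n} zero    c = trans (cong (c +_) (sum-replicate-zero n)) (+-identityʳ c)
∑-indicator {suc n} (suc x) c = ∑-indicator x c

+-cancelˡ-≡ᵇ : ∀ c a b → (c + a ≡ᵇ c + b) ≡ (a ≡ᵇ b)
+-cancelˡ-≡ᵇ zero    a b = refl
+-cancelˡ-≡ᵇ (suc c) a b = +-cancelˡ-≡ᵇ c a b

+-cancelʳ-≡ᵇ : ∀ a b c → (a + c ≡ᵇ b + c) ≡ (a ≡ᵇ b)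
+-cancelʳ-≡ᵇ a b c rewrite +-comm a c | +-comm b c = +-cancelˡ-≡ᵇ c a b

+1≡+2⇒≡suc : ∀ {a b} → a + 1 ≡ b + 2 → a ≡ suc b
+1≡+2⇒≡suc {a} {b} eq = +-cancelʳ-≡ 1 a (suc b) (trans eq (+-suc b 1))

Irreflexive : ∀ {n} → Adj n → Set
Irreflexive {n} G = ∀ (u : Fin n) → G u u ≡ false

indicator : Bool → ℕ
indicator b = if b then 1 else 0

deg-as-∑ : ∀ {n} (G : Adj n) u → deg G u ≡ ∑[ v < n ] indicator (G u v)
deg-as-∑ G u = sum-map-allFin (indicator ∘ G u)

δ-complement-nonadjacent : ∀ {n} (G : Adj n) u v →
  δ-complement G u v ≡ true → G u v ≡ false → deg G u ≡ deg G v
δ-complement-nonadjacent G u v δuv ¬Guv with deg G u ≡ᵇ deg G v in sameDeg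
... | true  = ≡ᵇ⇒≡ _ _ (Equivalence.from T-≡ sameDeg)
... | false = contradiction (trans (sym δuv) ¬Guv) λ ()

combine-≟ : ∀ {m k} (x x' : Fin m) (y : Fin k) →
            does (combine x y ≟ combine x' y) ≡ does (x ≟ x')
combine-≟ x x' y with x ≟ x'
... | yes refl = dec-true (combine x y ≟ combine x y) refl
... | no x≢x'  = dec-false (combine x y ≟ combine x' y) (x≢x' ∘ combine-injectiveˡ x y x' y)

module _ {m k} (G : Adj m) (H : Adj k) where

  adjacent : Fin m × Fin k → Fin m × Fin k → Bool
  adjacent (x , y) (x' , y') = (does (x ≟ x') ∧ H y y') ∨ (does (y ≟ y') ∧ G x x')

  □-remQuot : ∀ i j → (G □ H) i j ≡ adjacent (remQuot k i) (remQuot k j)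
  □-remQuot i j with remQuot {m} k i | remQuot {m} k j
  ... | _ , _ | _ , _ = refl

  □-combine : ∀ x y x' y' → (G □ H) (combine x y) (combine x' y')
                          ≡ (does (x ≟ x') ∧ H y y') ∨ (does (y ≟ y') ∧ G x x')
  □-combine x y x' y' =
    trans (□-remQuot (combine x y) (combine x' y'))
          (cong₂ adjacent (remQuot-combine x y) (remQuot-combine x' y'))

  □-combine-≢ : ∀ {x x' y y'} → x ≢ x' → y ≢ y' → (G □ H) (combine x y) (combine x' y') ≡ false
  □-combine-≢ {x} {x'} {y} {y'} x≢x' y≢y'
    rewrite □-combine x y x' y' | dec-false (x ≟ x') x≢x' | dec-false (y ≟ y') y≢y' = refl

  -- Only x' = x contributes to the inner sum through H, and only y' = y through G.
  ∑-□-fibre : Irreflexive G → ∀ x y x' →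
    ∑[ y' < k ] indicator ((G □ H) (combine x y) (combine x' y'))
      ≡ indicator (G x x') + (if does (x ≟ x') then deg H y else 0)
  ∑-□-fibre irr x y x' =
    trans (sum-cong-≗ (λ y' → cong indicator (□-combine x y x' y'))) (fibre (x ≟ x'))
    where
    fibre : ∀ x≟x' → ∑[ y' < k ] indicator ((does x≟x' ∧ H y y') ∨ (does (y ≟ y') ∧ G x x'))
                       ≡ indicator (G x x') + (if does x≟x' then deg H y else 0)
    fibre (yes refl) rewrite irr x = begin
      ∑[ y' < k ] indicator (H y y' ∨ (does (y ≟ y') ∧ false))
        ≡⟨ sum-cong-≗ (λ y' → cong indicator (trans (cong (H y y' ∨_) (∧-zeroʳ _)) (∨-identityʳ _))) ⟩
      ∑[ y' < k ] indicator (H y y')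
        ≡⟨ deg-as-∑ H y ⟨
      deg H y ∎
    fibre (no _) = begin
      ∑[ y' < k ] indicator (does (y ≟ y') ∧ G x x')
        ≡⟨ sum-cong-≗ (λ y' → indicator-∧ (does (y ≟ y'))) ⟩
      ∑[ y' < k ] (if does (y ≟ y') then indicator (G x x') else 0)
        ≡⟨ ∑-indicator y _ ⟩
      indicator (G x x')
        ≡⟨ +-identityʳ _ ⟨
      indicator (G x x') + 0 ∎
      where
      indicator-∧ : ∀ a → indicator (a ∧ G x x') ≡ (if a then indicator (G x x') else 0)
      indicator-∧ true  = refl
      indicator-∧ false = refl

  deg-□ : Irreflexive G → ∀ x y → deg (G □ H) (combine x y) ≡ deg G x + deg H y
  deg-□ irr x y = begin
    deg (G □ H) (combine x y)
      ≡⟨ deg-as-∑ (G □ H) (combine x y) ⟩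
    ∑[ j < m * k ] indicator ((G □ H) (combine x y) j)
      ≡⟨ ∑-combine m k _ ⟩
    ∑[ x' < m ] ∑[ y' < k ] indicator ((G □ H) (combine x y) (combine x' y'))
      ≡⟨ sum-cong-≗ (∑-□-fibre irr x y) ⟩
    ∑[ x' < m ] (indicator (G x x') + (if does (x ≟ x') then deg H y else 0))
      ≡⟨ ∑-distrib-+ (indicator ∘ G x) _ ⟩
    ∑[ x' < m ] indicator (G x x') + ∑[ x' < m ] (if does (x ≟ x') then deg H y else 0)
      ≡⟨ cong₂ _+_ (sym (deg-as-∑ G x)) (∑-indicator x (deg H y)) ⟩
    deg G x + deg H y ∎

  δ-complement-□-layer : Irreflexive G → Irreflexive H → ∀ x x' y →
    δ-complement (G □ H) (combine x y) (combine x' y) ≡ δ-complement G x x'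
  δ-complement-□-layer irrG irrH x x' y
    rewrite deg-□ irrG x y | deg-□ irrG x' y | +-cancelʳ-≡ᵇ (deg G x) (deg G x') (deg H y)
          | □-combine x y x' y | irrH y | dec-true (y ≟ y) refl | combine-≟ x x' y
          | ∧-zeroʳ (does (x ≟ x')) = refl

colourable-via-combine : ∀ {m k K} (A : Adj (m * k)) (c : Fin m → Fin k → Fin K) →
  (∀ x y x' y' → A (combine x y) (combine x' y') ≡ true → c x y ≢ c x' y') → Colourable A K
colourable-via-combine {m} {k} A c proper = uncurry c ∘ remQuot k , λ i j →
  proper-on-pairs (remQuot k i) (remQuot k j)
  ∘ subst₂ (λ i j → A i j ≡ true) (sym (combine-remQuot {m} k i)) (sym (combine-remQuot {m} k j))
  where
  proper-on-pairs : ∀ p q → A (uncurry combine p) (uncurry combine q) ≡ true → uncurry c p ≢ uncurry c q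
  proper-on-pairs (x , y) (x' , y') = proper x y x' y'

↑ˡ≢↑ʳ : ∀ {m n} (i : Fin m) (j : Fin n) → i ↑ˡ n ≢ m ↑ʳ j
↑ˡ≢↑ʳ {m} {n} i j eq with () ← trans (sym (splitAt-↑ˡ m i n)) (trans (cong (splitAt m) eq) (splitAt-↑ʳ m n j))

inject₁≢suc : ∀ {n} (i : Fin n) → inject₁ i ≢ suc i
inject₁≢suc (suc i) eq = inject₁≢suc i (suc-injective eq)

rotate : ∀ {n} → Fin (suc (suc n)) → Fin (suc (suc n))
rotate zero    = fromℕ _
rotate (suc i) = inject₁ i

rotate-injective : ∀ {n} (i j : Fin (suc (suc n))) → rotate i ≡ rotate j → i ≡ j
rotate-injective zero    zero    eq = refl
rotate-injective zero    (suc j) eq = contradiction eq fromℕ≢inject₁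
rotate-injective (suc i) zero    eq = contradiction (sym eq) fromℕ≢inject₁
rotate-injective (suc i) (suc j) eq = cong suc (inject₁-injective eq)

rotate-≢ : ∀ {n} (i : Fin (suc (suc n))) → rotate i ≢ i
rotate-≢ zero    ()
rotate-≢ (suc i) = inject₁≢suc i

P₃-irreflexive : Irreflexive P₃
P₃-irreflexive 0F = refl
P₃-irreflexive 1F = refl
P₃-irreflexive 2F = refl

module _ {n k} (G : Adj n) (G-irreflexive : Irreflexive G)
         (no-unit-gap : ∀ (u v : Fin n) → deg G v ≢ suc (deg G u))
         (c : Fin n → Fin (2 + k)) (c-proper : ∀ u v → δ-complement G u v ≡ true → c u ≢ c v)
         where

  K : ℕ
  K = 2 + k

  colour : Fin n → Fin 3 → Fin (K + K)
  colour x 0F = c x ↑ˡ K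
  colour x 1F = rotate (c x) ↑ˡ K
  colour x 2F = K ↑ʳ c x

  colour-injective-on-layer : ∀ y {x x'} → colour x y ≡ colour x' y → c x ≡ c x'
  colour-injective-on-layer 0F = ↑ˡ-injective K _ _
  colour-injective-on-layer 1F = rotate-injective _ _ ∘ ↑ˡ-injective K _ _
  colour-injective-on-layer 2F = ↑ʳ-injective K _ _

  colour-≢-2F : ∀ y {x x'} → y ≢ 2F → colour x y ≢ colour x' 2F
  colour-≢-2F 0F _   = ↑ˡ≢↑ʳ _ _
  colour-≢-2F 1F _   = ↑ˡ≢↑ʳ _ _
  colour-≢-2F 2F 2≢2 = contradiction refl 2≢2

  colour-≢-same-vertex : ∀ x y y' → y ≢ y' → colour x y ≢ colour x y'
  colour-≢-same-vertex x 0F 1F _   = rotate-≢ (c x) ∘ sym ∘ ↑ˡ-injective K _ _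
  colour-≢-same-vertex x 1F 0F _   = rotate-≢ (c x) ∘ ↑ˡ-injective K _ _
  colour-≢-same-vertex x y  2F y≢2 = colour-≢-2F y y≢2
  colour-≢-same-vertex x 2F y  2≢y = colour-≢-2F y (2≢y ∘ sym) ∘ sym
  colour-≢-same-vertex x 0F 0F 0≢0 = contradiction refl 0≢0
  colour-≢-same-vertex x 1F 1F 1≢1 = contradiction refl 1≢1

  colour-≢-off-diagonal : ∀ {x x'} y y' → y ≢ y' → deg G x + deg P₃ y ≡ deg G x' + deg P₃ y' →
                          colour x y ≢ colour x' y'
  colour-≢-off-diagonal {x} {x'} 0F 1F _ sameDeg = contradiction (+1≡+2⇒≡suc sameDeg) (no-unit-gap x' x)
  colour-≢-off-diagonal {x} {x'} 1F 0F _ sameDeg = contradiction (+1≡+2⇒≡suc (sym sameDeg)) (no-unit-gap x x')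
  colour-≢-off-diagonal y  2F y≢2 _ = colour-≢-2F y y≢2
  colour-≢-off-diagonal 2F y  2≢y _ = colour-≢-2F y (2≢y ∘ sym) ∘ sym
  colour-≢-off-diagonal 0F 0F 0≢0 _ = contradiction refl 0≢0
  colour-≢-off-diagonal 1F 1F 1≢1 _ = contradiction refl 1≢1

  colour-δ-proper : ∀ x y x' y' → δ-complement (G □ P₃) (combine x y) (combine x' y') ≡ true →
                    colour x y ≢ colour x' y'
  colour-δ-proper x y x' y' δ with y ≟ y' | x ≟ x'
  ... | yes refl | _ =
    c-proper x x' (trans (sym (δ-complement-□-layer G P₃ G-irreflexive P₃-irreflexive x x' y)) δ)
    ∘ colour-injective-on-layer y
  ... | no y≢y' | yes refl = colour-≢-same-vertex x y y' y≢y'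
  ... | no y≢y' | no x≢x' = colour-≢-off-diagonal y y' y≢y' (begin
    deg G x + deg P₃ y              ≡⟨ deg-□ G P₃ G-irreflexive x y ⟨
    deg (G □ P₃) (combine x y)      ≡⟨ δ-complement-nonadjacent (G □ P₃) _ _ δ (□-combine-≢ G P₃ x≢x' y≢y') ⟩
    deg (G □ P₃) (combine x' y')    ≡⟨ deg-□ G P₃ G-irreflexive x' y' ⟩
    deg G x' + deg P₃ y'            ∎)

  δ-colourable-□P₃ : Colourable (δ-complement (G □ P₃)) (K + K)
  δ-colourable-□P₃ = colourable-via-combine (δ-complement (G □ P₃)) colour colour-δ-proper

mainTheorem8 : (n : ℕ) (G : Adj n) → IsSimple G
    → (k : ℕ) → IsδChromaticNumber G k → 2 ≤ k
    → (∀ (u v : Fin n) → deg G v ≢ suc (deg G u))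
    → (k' : ℕ) → IsδChromaticNumber (G □ P₃) k'
    → k' ≤ 2 * k
mainTheorem8 n G simple (suc (suc k)) ((c , c-proper) , _) (s≤s (s≤s z≤n)) no-unit-gap k' (_ , minimal) =
  minimal (2 * suc (suc k))
    (subst (Colourable (δ-complement (G □ P₃))) (cong (suc (suc k) +_) (sym (+-identityʳ _)))
           (δ-colourable-□P₃ G (IsSimple.irreflexive simple) no-unit-gap c c-proper))
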